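{- The only pairs of non-negative integers $(x,a)$ satisfying $$x^6+3x^5+5x^4+6x^3+7x^2+6x+3=a^2+a+1$$ are $(x,a)=(0,1)$ and $(x,a)=(1,5)$. -}

module Submission where

-- Multiplying by 64 turns both sides into near-squares: 64·f(a) = s² + 48 with
-- s = 8a + 4, while 64·P(x) lies strictly between r² + 48 and (r + 1)² + 48 for
-- r = root(x) = 8x³ + 12x² + 11x + 7, the upper bound holding as soon as the
-- cubic 8x³ dominates the quadratic 135x² + 208x + 80, i.e. for x ≥ 19.  A
-- solution with x ≥ 19 would put the square s² strictly between r² and (r + 1)²,
-- which is impossible.  For 2 ≤ x ≤ 18 the value P(x) is checked by evaluation
-- to lie strictly between two consecutive values f(k) < f(k + 1); since f is
-- strictly increasing it is then not a value of f.  The cases x = 0, 1 give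
-- P(x) = f(1), f(5), and injectivity of f pins down a.

open import Data.Nat using (ℕ; suc; _+_; _*_; _^_; _≤_; _<_; _<ᵇ_; z<s)
open import Data.Nat.Properties
open import Data.Nat.Solver using (module +-*-Solver)
open import Data.Bool using (T)
open import Data.Product using (_×_; _,_)
open import Data.Sum using (_⊎_; inj₁; inj₂)
open import Data.Empty using (⊥; ⊥-elim)
open import Relation.Nullary using (yes; no)
open import Relation.Binary using (tri<; tri≈; tri>)
open import Relation.Binary.PropositionalEquality
  using (_≡_; _≢_; refl; sym; trans; cong; subst)
open import Function.Bundles using (_⇔_; mk⇔)

open +-*-Solver using (solve; _:+_; _:*_; _:^_; _:=_; con)

P : ℕ → ℕ
P x = x ^ 6 + 3 * x ^ 5 + 5 * x ^ 4 + 6 * x ^ 3 + 7 * x ^ 2 + 6 * x + 3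

f : ℕ → ℕ
f a = a ^ 2 + a + 1

f-monotone : ∀ {a b} → a ≤ b → f a ≤ f b
f-monotone a≤b = +-monoˡ-≤ 1 (+-mono-≤ (^-monoˡ-≤ 2 a≤b) a≤b)

f-strictlyMonotone : ∀ {a b} → a < b → f a < f b
f-strictlyMonotone a<b = +-monoˡ-< 1 (+-mono-< (^-monoˡ-< 2 a<b) a<b)

f-injective : ∀ {a b} → f a ≡ f b → a ≡ b
f-injective {a} {b} fa≡fb with <-cmp a b
... | tri< a<b _ _ = ⊥-elim (<-irrefl fa≡fb (f-strictlyMonotone a<b))
... | tri≈ _ a≡b _ = a≡b
... | tri> _ _ b<a = ⊥-elim (<-irrefl (sym fa≡fb) (f-strictlyMonotone b<a))

not-a-value-of-f : ∀ k {N} → f k < N → N < f (suc k) → ∀ a → N ≢ f a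
not-a-value-of-f k {N} fk<N N<fk+1 a N≡fa with a ≤? k
... | yes a≤k = <-irrefl (sym N≡fa) (≤-<-trans (f-monotone a≤k) fk<N)
... | no  a≰k = <-irrefl N≡fa (<-≤-trans N<fk+1 (f-monotone (≰⇒> a≰k)))

-- The same, for the concrete numbers P x: both inequalities are closed
-- boolean comparisons, discharged by evaluation at the use site.
excluded-by : ∀ k x → T (f k <ᵇ P x) → T (P x <ᵇ f (suc k)) → ∀ a → P x ≢ f a
excluded-by k x lower upper = not-a-value-of-f k (<ᵇ⇒< _ _ lower) (<ᵇ⇒< _ _ upper)

no-square-strictly-between : ∀ m n → m * m < n * n → n * n < suc m * suc m → ⊥
no-square-strictly-between m n m²<n² n²<[1+m]² =
  <⇒≱ n²<[1+m]² (*-mono-≤ m<n m<n)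
  where
  m<n : m < n
  m<n = ≰⇒> (λ n≤m → <⇒≱ m²<n² (*-mono-≤ n≤m n≤m))

64f-as-square : ∀ a → 64 * f a ≡ (8 * a + 4) * (8 * a + 4) + 48
64f-as-square = solve 1
  (λ a → con 64 :* (a :^ 2 :+ a :+ con 1)
      := (con 8 :* a :+ con 4) :* (con 8 :* a :+ con 4) :+ con 48)
  refl

-- The approximate square root of 64·P(x) - 48: for x ≥ 19 that number lies
-- strictly between root(x)² and (root(x) + 1)², by the next two identities.
root : ℕ → ℕ
root x = 8 * x ^ 3 + 12 * x ^ 2 + 11 * x + 7

64P-above-root² : ∀ x →
  64 * P x ≡ root x * root x + suc (8 * x ^ 3 + 159 * x ^ 2 + 230 * x + 94) + 48
64P-above-root² = solve 1
  (λ x → con 64 :* (x :^ 6 :+ con 3 :* x :^ 5 :+ con 5 :* x :^ 4 :+ con 6 :* x :^ 3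
                     :+ con 7 :* x :^ 2 :+ con 6 :* x :+ con 3)
      := (con 8 :* x :^ 3 :+ con 12 :* x :^ 2 :+ con 11 :* x :+ con 7)
           :* (con 8 :* x :^ 3 :+ con 12 :* x :^ 2 :+ con 11 :* x :+ con 7)
         :+ (con 1 :+ (con 8 :* x :^ 3 :+ con 159 :* x :^ 2 :+ con 230 :* x :+ con 94))
         :+ con 48)
  refl

64P-below-[root+1]² : ∀ x →
  64 * P x + 8 * x ^ 3 ≡ suc (root x) * suc (root x) + 48 + (135 * x ^ 2 + 208 * x + 80)
64P-below-[root+1]² = solve 1
  (λ x → con 64 :* (x :^ 6 :+ con 3 :* x :^ 5 :+ con 5 :* x :^ 4 :+ con 6 :* x :^ 3
                     :+ con 7 :* x :^ 2 :+ con 6 :* x :+ con 3)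
         :+ con 8 :* x :^ 3
      := (con 1 :+ (con 8 :* x :^ 3 :+ con 12 :* x :^ 2 :+ con 11 :* x :+ con 7))
           :* (con 1 :+ (con 8 :* x :^ 3 :+ con 12 :* x :^ 2 :+ con 11 :* x :+ con 7))
         :+ con 48 :+ (con 135 :* x :^ 2 :+ con 208 :* x :+ con 80))
  refl

-- For x ≥ 19 the cubic term dominates: writing x = 19 + y, the difference
-- 8x³ - (135x² + 208x + 80) is a polynomial in y with positive coefficients.
cubic-dominates : ∀ y → let x = 19 + y in 135 * x ^ 2 + 208 * x + 80 < 8 * x ^ 3
cubic-dominates y =
  subst (quadratic <_) (expansion y) (m<m+n quadratic z<s)
  where
  quadratic : ℕ
  quadratic = 135 * (19 + y) ^ 2 + 208 * (19 + y) + 80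
  expansion : ∀ y →
    135 * (19 + y) ^ 2 + 208 * (19 + y) + 80
      + suc (8 * y ^ 3 + 321 * y ^ 2 + 3326 * y + 2104) ≡ 8 * (19 + y) ^ 3
  expansion = solve 1
    (λ y → con 135 :* (con 19 :+ y) :^ 2 :+ con 208 :* (con 19 :+ y) :+ con 80
             :+ (con 1 :+ (con 8 :* y :^ 3 :+ con 321 :* y :^ 2 :+ con 3326 :* y :+ con 2104))
        := con 8 :* (con 19 :+ y) :^ 3)
    refl

-- For x ≥ 19, P x is not a value of f: otherwise 8a + 4 would lie strictly
-- between root(x) and root(x) + 1.
no-large-solution : ∀ y a → P (19 + y) ≢ f a
no-large-solution y a P≡f =
  no-square-strictly-between (root x) s root²<s² s²<[root+1]²
  where
  open ≤-Reasoning
  x s : ℕ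
  x = 19 + y
  s = 8 * a + 4

  64P≡s²+48 : 64 * P x ≡ s * s + 48
  64P≡s²+48 = trans (cong (64 *_) P≡f) (64f-as-square a)

  root²<s² : root x * root x < s * s
  root²<s² = +-cancelʳ-< 48 _ _ (begin-strict
    root x * root x + 48  <⟨ +-monoˡ-< 48 (m<m+n (root x * root x) z<s) ⟩
    root x * root x + suc (8 * x ^ 3 + 159 * x ^ 2 + 230 * x + 94) + 48
                          ≡⟨ sym (64P-above-root² x) ⟩
    64 * P x              ≡⟨ 64P≡s²+48 ⟩
    s * s + 48            ∎)

  s²<[root+1]² : s * s < suc (root x) * suc (root x)
  s²<[root+1]² = +-cancelʳ-< 48 _ _ (+-cancelʳ-< (8 * x ^ 3) _ _ (begin-strict
    s * s + 48 + 8 * x ^ 3       ≡⟨ cong (_+ 8 * x ^ 3) (sym 64P≡s²+48) ⟩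
    64 * P x + 8 * x ^ 3         ≡⟨ 64P-below-[root+1]² x ⟩
    suc (root x) * suc (root x) + 48 + (135 * x ^ 2 + 208 * x + 80)
                                 <⟨ +-monoʳ-< (suc (root x) * suc (root x) + 48) (cubic-dominates y) ⟩
    suc (root x) * suc (root x) + 48 + 8 * x ^ 3 ∎))

solutions : ∀ x a → P x ≡ f a → (x ≡ 0 × a ≡ 1) ⊎ (x ≡ 1 × a ≡ 5)
solutions 0  a eq = inj₁ (refl , f-injective (sym eq))
solutions 1  a eq = inj₂ (refl , f-injective (sym eq))
solutions 2  a eq = ⊥-elim (excluded-by 17 2 _ _ a eq)
solutions 3  a eq = ⊥-elim (excluded-by 45 3 _ _ a eq)
solutions 4  a eq = ⊥-elim (excluded-by 94 4 _ _ a eq)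
solutions 5  a eq = ⊥-elim (excluded-by 170 5 _ _ a eq)
solutions 6  a eq = ⊥-elim (excluded-by 278 6 _ _ a eq)
solutions 7  a eq = ⊥-elim (excluded-by 426 7 _ _ a eq)
solutions 8  a eq = ⊥-elim (excluded-by 619 8 _ _ a eq)
solutions 9  a eq = ⊥-elim (excluded-by 863 9 _ _ a eq)
solutions 10 a eq = ⊥-elim (excluded-by 1164 10 _ _ a eq)
solutions 11 a eq = ⊥-elim (excluded-by 1528 11 _ _ a eq)
solutions 12 a eq = ⊥-elim (excluded-by 1961 12 _ _ a eq)
solutions 13 a eq = ⊥-elim (excluded-by 2468 13 _ _ a eq)
solutions 14 a eq = ⊥-elim (excluded-by 3057 14 _ _ a eq)
solutions 15 a eq = ⊥-elim (excluded-by 3733 15 _ _ a eq)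
solutions 16 a eq = ⊥-elim (excluded-by 4502 16 _ _ a eq)
solutions 17 a eq = ⊥-elim (excluded-by 5370 17 _ _ a eq)
solutions 18 a eq = ⊥-elim (excluded-by 6343 18 _ _ a eq)
solutions (suc (suc (suc (suc (suc (suc (suc (suc (suc (suc
          (suc (suc (suc (suc (suc (suc (suc (suc (suc y))))))))))))))))))) a eq =
  ⊥-elim (no-large-solution y a eq)

lemma5 : (x a : ℕ) →
    (x ^ 6 + 3 * x ^ 5 + 5 * x ^ 4 + 6 * x ^ 3 + 7 * x ^ 2 + 6 * x + 3 ≡ a ^ 2 + a + 1)
    ⇔ ((x ≡ 0 × a ≡ 1) ⊎ (x ≡ 1 × a ≡ 5))
lemma5 x a = mk⇔ (solutions x a) (is-solution x a)
  where
  is-solution : ∀ x a → (x ≡ 0 × a ≡ 1) ⊎ (x ≡ 1 × a ≡ 5) → P x ≡ f a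
  is-solution .0 .1 (inj₁ (refl , refl)) = refl
  is-solution .1 .5 (inj₂ (refl , refl)) = refl
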